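{- Let $k\geq 4$ and $0\leq \alpha\leq k-2$ be integers. Let $A$ be a set of $k$ positive integers such that \[|\Sigma_{\alpha}(A)|=\frac{k(k+1)}{2}-\frac{\alpha(\alpha+1)}{2}+1.\] Then $A=d*[1,k]$ for some positive integer $d$.
   Context: For a finite set $A$ of integers with $|A|=k$ and an integer $0\leq\alpha\leq k$, $\Sigma_{\alpha}(A)=\{s(B): B\subseteq A,\ |B|\geq \alpha\}$, where $s(B)=\sum_{b\in B} b$ and $s(\emptyset)=0$. For integers $a\leq b$, $[a,b]=\{a,a+1,\ldots,b\}$, and for an integer $d$ and a set $X$, $d*X=\{dx: x\in X\}$. -}

module Defs where

open import Data.Nat using (ℕ; zero; suc; _+_; _*_; _≤_; _<_)
import Data.Nat
import Relation.Nullary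
open import Data.Nat.Properties using (_≟_)
open import Data.Bool using (Bool; true; false)
open import Data.List using (List; []; _∷_; _++_; map; length; deduplicate)
open import Data.Vec using (Vec; []; _∷_)
open import Data.Fin using (Fin)
open import Data.Fin.Subset using (Subset; ∣_∣)
open import Data.Product using (Σ; _×_; _,_)
open import Relation.Binary.PropositionalEquality using (_≡_)

allSubsets : (k : ℕ) → List (Subset k)
allSubsets zero = [] ∷ []
allSubsets (suc k) = map (true ∷_) (allSubsets k) ++ map (false ∷_) (allSubsets k)

subsetSum : {k : ℕ} → Vec ℕ k → Subset k → ℕ
subsetSum [] [] = 0
subsetSum (a ∷ as) (true ∷ b) = a + subsetSum as b
subsetSum (a ∷ as) (false ∷ b) = subsetSum as b

keepLarge : {k : ℕ} → ℕ → List (Subset k) → List (Subset k)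
keepLarge α [] = []
keepLarge α (B ∷ Bs) with Data.Nat._≤?_ α ∣ B ∣
... | Relation.Nullary.yes _ = B ∷ keepLarge α Bs
... | Relation.Nullary.no _ = keepLarge α Bs

Sigma : {k : ℕ} → ℕ → Vec ℕ k → List ℕ
Sigma {k} α A = deduplicate _≟_ (map (subsetSum A) (keepLarge α (allSubsets k)))

cardSigma : {k : ℕ} → ℕ → Vec ℕ k → ℕ
cardSigma α A = length (Sigma α A)

-- Put T = s(A), β = k − α ≥ 2, and list A decreasingly as r.  Taking complements,
-- T − s(L) ∈ Σ_α(A) for every collection L of at most β entries of A.  The chain
--   chain β (x ∷ r′) = (x + chain (β − 1) r′) ++ r′ ++ [0]
-- is a strictly decreasing list of such sums s(L), of length k(k+1)/2 − α(α+1)/2 + 1.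
-- Hence, by the hypothesis and the pigeonhole principle, the numbers T − c with c in the
-- chain exhaust Σ_α(A); since β ≥ 2 every sum of two distinct entries of A lies in the chain.
-- This forces an arithmetic progression: for r = y ∷ z ∷ w and d = y − z, the place of z + u
-- (u ∈ w) in the chain shows that u = d or u − d ∈ w, so w = [m d, …, 2d, d]; as m ≥ 2
-- (i.e. k ≥ 4) the sum m d + d of two distinct entries of w must be z, and y = z + d.

module Submission where

open import Defs
open import Data.Nat using (ℕ; _+_; _*_; _≤_; _<_; _∸_)
open import Data.Vec using (Vec)
open import Data.Vec.Membership.Propositional using (_∈_)
open import Data.Vec.Relation.Unary.Unique.Propositional using (Unique)
open import Data.Vec.Relation.Unary.All using (All)
open import Data.Product using (Σ; _×_; _,_)
open import Function.Bundles using (_⇔_)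
open import Relation.Binary.PropositionalEquality using (_≡_)

open import Data.Nat using (zero; suc; _>_; z≤n; s≤s; _≤?_)
open import Data.Nat.Properties
open import Data.Nat.ListAction using (sum)
open import Data.Nat.ListAction.Properties using (sum-↭)
open import Data.Nat.Tactic.RingSolver using (solve-∀)
open import Data.Bool using (true; false)
open import Data.Sum using (_⊎_; inj₁; inj₂; map₂)
open import Data.Product using (proj₁; proj₂)
open import Data.Fin.Subset using (Subset; ∣_∣)
open import Function using (flip; _∘_; id; mk⇔)
open import Relation.Nullary using (¬_; yes; no; contradiction)
open import Relation.Binary.PropositionalEquality
open import Relation.Binary.Construct.Flip.EqAndOrd using () renaming (decTotalOrder to flipped)

open import Data.List using (List; []; _∷_; _++_; length; map; filter)
open import Data.List.Properties using (length-++; length-map)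
open import Data.List.Membership.Propositional using () renaming (_∈_ to _∈ₗ_)
open import Data.List.Membership.Propositional.Properties
  using (∈-++⁺ˡ; ∈-++⁺ʳ; ∈-map⁺; ∈-map⁻; ∈-++⁻; ∈-deduplicate⁺; ∈-filter⁺; ∈-filter⁻)
open import Data.List.Membership.DecPropositional _≟_ using (_∈?_)
open import Data.List.Membership.Propositional.Properties.WithK using (unique∧set⇒bag)
open import Data.List.Relation.Unary.Any using (here; there)
open import Data.List.Relation.Unary.All as Allₗ using ([]; _∷_) renaming (All to Allₗ)
import Data.List.Relation.Unary.All.Properties as Allₚ
open import Data.List.Relation.Unary.AllPairs as AllPairs using (AllPairs; []; _∷_)
import Data.List.Relation.Unary.AllPairs.Properties as AllPairsₚ
open import Data.List.Relation.Unary.Linked.Properties using (Linked⇒AllPairs)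
open import Data.List.Relation.Unary.Unique.Propositional using () renaming (Unique to Uniqueₗ)
import Data.List.Relation.Unary.Unique.Propositional.Properties as Uniqueₗ
open import Data.List.Relation.Unary.Unique.DecPropositional.Properties _≟_ using (deduplicate-!)
open import Data.List.Relation.Binary.Sublist.Propositional
  using ([]; _∷_; _∷ʳ_; minimum; from∈) renaming (_⊆_ to _⊑_)
open import Data.List.Relation.Binary.Sublist.Propositional.Properties
  using (filter-⊆; All-resp-⊆; Any-resp-⊆)
open import Data.List.Relation.Binary.Permutation.Propositional using (_↭_; ↭-sym; ↭⇒↭ₛ)
open import Data.List.Relation.Binary.Permutation.Propositional.Properties
  using (↭-length; ∈-resp-↭; All-resp-↭)
open import Data.List.Relation.Binary.Permutation.Setoid.Properties (setoid ℕ) using (Unique-resp-↭)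
open import Data.List.Relation.Binary.BagAndSetEquality using (∼bag⇒↭)
open import Data.List.Sort (flipped ≤-decTotalOrder) using (sort; sort-↭; sort-↗)
import Data.List.Fresh as Fresh
open import Data.List.Fresh.Relation.Unary.Any using () renaming (here to here#; there to there#)
open import Data.List.Fresh.Membership.Setoid (setoid ℕ) using () renaming (_∈_ to _∈#_)
open import Data.List.Fresh.Membership.Setoid.Properties (setoid ℕ) using (strict-injection)

open import Data.Vec using (toList) renaming ([] to []ᵛ; _∷_ to _∷ᵛ_)
open import Data.Vec.Properties using (length-toList)
open import Data.Vec.Membership.Propositional.Properties using (∈-toList⁺; ∈-toList⁻)
import Data.Vec.Relation.Unary.All.Properties as VecAll
import Data.Vec.Relation.Unary.AllPairs as VecAllPairs

∈-allSubsets : ∀ {k} (B : Subset k) → B ∈ₗ allSubsets k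
∈-allSubsets {zero}  []ᵛ          = here refl
∈-allSubsets {suc k} (true ∷ᵛ B)  = ∈-++⁺ˡ (∈-map⁺ (true ∷ᵛ_) (∈-allSubsets B))
∈-allSubsets {suc k} (false ∷ᵛ B) =
  ∈-++⁺ʳ (map (true ∷ᵛ_) (allSubsets k)) (∈-map⁺ (false ∷ᵛ_) (∈-allSubsets B))

∈-keepLarge : ∀ {k} α {Bs : List (Subset k)} {B} → B ∈ₗ Bs → α ≤ ∣ B ∣ → B ∈ₗ keepLarge α Bs
∈-keepLarge α {B′ ∷ Bs} B∈ α≤∣B∣ with α ≤? ∣ B′ ∣ | B∈
... | yes _    | here refl = here refl
... | no  α≰B′ | here refl = contradiction α≤∣B∣ α≰B′
... | yes _    | there B∈Bs = there (∈-keepLarge α B∈Bs α≤∣B∣)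
... | no  _    | there B∈Bs = ∈-keepLarge α B∈Bs α≤∣B∣

subsetSum∈Sigma : ∀ {k} α (A : Vec ℕ k) (B : Subset k) → α ≤ ∣ B ∣ → subsetSum A B ∈ₗ Sigma α A
subsetSum∈Sigma α A B α≤∣B∣ =
  ∈-deduplicate⁺ _≟_ (∈-map⁺ (subsetSum A) (∈-keepLarge α (∈-allSubsets B) α≤∣B∣))

complement : ∀ {k} (A : Vec ℕ k) {L} → L ⊑ toList A →
             Σ (Subset k) λ B → (∣ B ∣ + length L ≡ k) × (subsetSum A B + sum L ≡ sum (toList A))
complement []ᵛ       []        = []ᵛ , refl , refl
complement (a ∷ᵛ A) (.a ∷ʳ L⊑A) =
  let B , |B|+|L| , sB+sL = complement A L⊑A
  in true ∷ᵛ B , cong suc |B|+|L| , trans (+-assoc a _ _) (cong (a +_) sB+sL)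
complement (a ∷ᵛ A) {a ∷ L} (refl ∷ L⊑A) =
  let B , |B|+|L| , sB+sL = complement A L⊑A
  in false ∷ᵛ B , trans (+-suc ∣ B ∣ _) (cong suc |B|+|L|) ,
     (begin
       subsetSum A B + (a + sum L) ≡⟨ +-comm (subsetSum A B) _ ⟩
       (a + sum L) + subsetSum A B ≡⟨ +-assoc a _ _ ⟩
       a + (sum L + subsetSum A B) ≡⟨ cong (a +_) (trans (+-comm (sum L) _) sB+sL) ⟩
       a + sum (toList A)          ∎)
  where open ≡-Reasoning

reorderAsSublist : ∀ {xs L : List ℕ} → Uniqueₗ xs → Uniqueₗ L → (∀ {z} → z ∈ₗ L → z ∈ₗ xs) →
                   Σ (List ℕ) λ L′ → L′ ⊑ xs × L′ ↭ L
reorderAsSublist {xs} {L} uxs uL L⊆xs =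
  L′ , filter-⊆ (_∈? L) xs , ∼bag⇒↭ (unique∧set⇒bag (Uniqueₗ.filter⁺ (_∈? L) {xs} uxs) uL sameElements)
  where
  L′ : List ℕ
  L′ = filter (_∈? L) xs
  sameElements : ∀ {z} → z ∈ₗ L′ ⇔ z ∈ₗ L
  sameElements = mk⇔ (λ z∈L′ → proj₂ (∈-filter⁻ (_∈? L) {xs = xs} z∈L′))
                     (λ z∈L → ∈-filter⁺ (_∈? L) (L⊆xs z∈L) z∈L)

unique-toList : ∀ {k} {A : Vec ℕ k} → Unique A → Uniqueₗ (toList A)
unique-toList VecAllPairs.[]          = []
unique-toList (a∉A VecAllPairs.∷ uA) = VecAll.toList⁺ a∉A ∷ unique-toList uA

complement∈Sigma : ∀ {k} α (A : Vec ℕ k) → Unique A → {L : List ℕ} → Uniqueₗ L →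
                   (∀ {z} → z ∈ₗ L → z ∈ A) → α + length L ≤ k →
                   Σ ℕ λ s → s ∈ₗ Sigma α A × s + sum L ≡ sum (toList A)
complement∈Sigma {k} α A uA {L} uL L⊆A α+|L|≤k =
  subsetSum A B , subsetSum∈Sigma α A B α≤∣B∣ , sB+sL
  where
  reordered : Σ (List ℕ) λ L′ → L′ ⊑ toList A × L′ ↭ L
  reordered = reorderAsSublist (unique-toList uA) uL (∈-toList⁺ ∘ L⊆A)
  L′ : List ℕ
  L′ = proj₁ reordered
  L′↭L : L′ ↭ L
  L′↭L = proj₂ (proj₂ reordered)
  completed : Σ (Subset k) λ B → (∣ B ∣ + length L′ ≡ k) × (subsetSum A B + sum L′ ≡ sum (toList A))
  completed = complement A (proj₁ (proj₂ reordered))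
  B : Subset k
  B = proj₁ completed
  |B|+|L|≡k : ∣ B ∣ + length L ≡ k
  |B|+|L|≡k = trans (cong (∣ B ∣ +_) (sym (↭-length L′↭L))) (proj₁ (proj₂ completed))
  α≤∣B∣ : α ≤ ∣ B ∣
  α≤∣B∣ = +-cancelʳ-≤ (length L) α ∣ B ∣ (subst (α + length L ≤_) (sym |B|+|L|≡k) α+|L|≤k)
  sB+sL : subsetSum A B + sum L ≡ sum (toList A)
  sB+sL = trans (cong (subsetSum A B +_) (sym (sum-↭ L′↭L))) (proj₂ (proj₂ completed))

Decreasing : List ℕ → Set
Decreasing = AllPairs _>_

decreasingEnumeration : ∀ {k} (A : Vec ℕ k) → Unique A →
                        Σ (List ℕ) λ r → Decreasing r × r ↭ toList A
decreasingEnumeration A uA = sort (toList A) , decreasing , sort-↭ (toList A)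
  where
  decreasing : Decreasing (sort (toList A))
  decreasing = AllPairs.zipWith (λ (x≥y , x≢y) → ≤∧≢⇒< x≥y (x≢y ∘ sym))
    (Linked⇒AllPairs (flip ≤-trans) (sort-↗ (toList A)) ,
     Unique-resp-↭ (↭⇒↭ₛ (↭-sym (sort-↭ (toList A)))) (unique-toList uA))

≤-head : ∀ {x r u} → Decreasing (x ∷ r) → u ∈ₗ x ∷ r → u ≤ x
≤-head _         (here refl) = ≤-refl
≤-head (x>r ∷ _) (there u∈r) = <⇒≤ (Allₗ.lookup x>r u∈r)

AllPairs-⊑ : ∀ {R : ℕ → ℕ → Set} {L r} → L ⊑ r → AllPairs R r → AllPairs R L
AllPairs-⊑ []           []        = []
AllPairs-⊑ (_ ∷ʳ L⊑r)   (_ ∷ pr)  = AllPairs-⊑ L⊑r pr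
AllPairs-⊑ (refl ∷ L⊑r) (px ∷ pr) = All-resp-⊆ L⊑r px ∷ AllPairs-⊑ L⊑r pr

chain : ℕ → List ℕ → List ℕ
chain zero    r       = 0 ∷ []
chain (suc b) []      = 0 ∷ []
chain (suc b) (x ∷ r) = map (x +_) (chain b r) ++ r ++ 0 ∷ []

∈-chain⁻ : ∀ {b x r c} → c ∈ₗ chain (suc b) (x ∷ r) →
           (Σ ℕ λ c′ → c′ ∈ₗ chain b r × c ≡ x + c′) ⊎ c ∈ₗ r ⊎ c ≡ 0
∈-chain⁻ {b} {x} {r} c∈ with ∈-++⁻ (map (x +_) (chain b r)) c∈
... | inj₁ c∈shifted = inj₁ (∈-map⁻ (x +_) c∈shifted)
... | inj₂ c∈rest with ∈-++⁻ r c∈rest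
...   | inj₁ c∈r       = inj₂ (inj₁ c∈r)
...   | inj₂ (here c≡0) = inj₂ (inj₂ c≡0)

chain⊆sublistSums : ∀ b r {c} → c ∈ₗ chain b r → Σ (List ℕ) λ L → L ⊑ r × length L ≤ b × sum L ≡ c
chain⊆sublistSums zero    r       (here refl) = [] , minimum r , z≤n , refl
chain⊆sublistSums (suc b) []      (here refl) = [] , [] , z≤n , refl
chain⊆sublistSums (suc b) (x ∷ r) c∈ with ∈-chain⁻ {b} {x} {r} c∈
... | inj₁ (c′ , c′∈ , refl) =
  let L , L⊑r , |L|≤b , sL = chain⊆sublistSums b r c′∈
  in x ∷ L , refl ∷ L⊑r , s≤s |L|≤b , cong (x +_) sL
... | inj₂ (inj₁ c∈r) = _ ∷ [] , x ∷ʳ from∈ c∈r , s≤s z≤n , +-identityʳ _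
... | inj₂ (inj₂ refl) = [] , minimum (x ∷ r) , z≤n , refl

≥-shift : ∀ {x xs a} → a ∈ₗ map (x +_) xs → x ≤ a
≥-shift {x} a∈ with ∈-map⁻ (x +_) a∈
... | c , _ , refl = m≤m+n x c

-- The blocks x + chain b r, r and [0] are each decreasing and lie strictly above one another.
chain-decreasing : ∀ b r → Decreasing r → Allₗ (0 <_) r → Decreasing (chain b r)
chain-decreasing zero    r       _ _ = [] ∷ []
chain-decreasing (suc b) []      _ _ = [] ∷ []
chain-decreasing (suc b) (x ∷ r) (x>r ∷ dr) (0<x ∷ 0<r) =
  AllPairsₚ.++⁺ shifted (AllPairsₚ.++⁺ dr ([] ∷ []) (Allₗ.map (_∷ []) 0<r))
    (Allₗ.tabulate λ a∈ → Allₚ.++⁺ (Allₗ.map (λ u<x → <-≤-trans u<x (≥-shift a∈)) x>r)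
                                 (<-≤-trans 0<x (≥-shift a∈) ∷ []))
  where
  shifted : Decreasing (map (x +_) (chain b r))
  shifted = AllPairsₚ.map⁺ (AllPairs.map (+-monoʳ-< x) (chain-decreasing b r dr 0<r))

chain-length : ∀ b m r → b + m ≡ length r →
               2 * length (chain b r) + m * (m + 1) ≡ length r * (length r + 1) + 2
chain-length zero    m r       refl = +-comm 2 (m * (m + 1))
chain-length (suc b) m (x ∷ r) b+m≡n =
  begin
    2 * length (chain (suc b) (x ∷ r)) + t ≡⟨ cong (λ ℓ → 2 * ℓ + t) blocks ⟩
    2 * (ℓ + (n + 1)) + t                 ≡⟨ regroup ℓ n t ⟩
    (2 * ℓ + t) + 2 * (n + 1)             ≡⟨ cong (_+ 2 * (n + 1)) (chain-length b m r (suc-injective b+m≡n)) ⟩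
    (n * (n + 1) + 2) + 2 * (n + 1)       ≡⟨ step n ⟩
    suc n * (suc n + 1) + 2               ∎
  where
  open ≡-Reasoning
  n = length r
  ℓ = length (chain b r)
  t = m * (m + 1)
  blocks : length (chain (suc b) (x ∷ r)) ≡ ℓ + (n + 1)
  blocks = trans (length-++ (map (x +_) (chain b r)))
                 (cong₂ _+_ (length-map (x +_) (chain b r)) (length-++ r))
  regroup : ∀ ℓ n t → 2 * (ℓ + (n + 1)) + t ≡ (2 * ℓ + t) + 2 * (n + 1)
  regroup = solve-∀
  step : ∀ n → (n * (n + 1) + 2) + 2 * (n + 1) ≡ suc n * (suc n + 1) + 2
  step = solve-∀

chain-below-head : ∀ {b x r c} → c ∈ₗ chain (suc b) (x ∷ r) → c < x → c ∈ₗ r ⊎ c ≡ 0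
chain-below-head {b} {x} {r} c∈ c<x with ∈-chain⁻ {b} {x} {r} c∈
... | inj₁ (c′ , _ , refl) = contradiction (m≤m+n x c′) (<⇒≱ c<x)
... | inj₂ c∈r⊎c≡0        = c∈r⊎c≡0

chain-from-head : ∀ {b x r c} → Allₗ (_< x) r → 0 < x → c ∈ₗ chain (suc b) (x ∷ r) → x ≤ c →
                  Σ ℕ λ c′ → c′ ∈ₗ chain b r × c ≡ x + c′
chain-from-head {b} {x} {r} r<x 0<x c∈ x≤c with ∈-chain⁻ {b} {x} {r} c∈
... | inj₁ shifted         = shifted
... | inj₂ (inj₁ c∈r)      = contradiction (Allₗ.lookup r<x c∈r) (≤⇒≯ x≤c)
... | inj₂ (inj₂ refl)     = contradiction 0<x (≤⇒≯ x≤c)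

∈-fromList⁺ : ∀ {xs : List ℕ} {z} (uxs : Uniqueₗ xs) → z ∈ₗ xs → z ∈# Fresh.fromList uxs
∈-fromList⁺ (_ ∷ _)   (here z≡x)   = here# z≡x
∈-fromList⁺ (_ ∷ uxs) (there z∈xs) = there# (∈-fromList⁺ uxs z∈xs)

∈-fromList⁻ : ∀ {xs : List ℕ} {z} (uxs : Uniqueₗ xs) → z ∈# Fresh.fromList uxs → z ∈ₗ xs
∈-fromList⁻ (_ ∷ _)   (here# z≡x)   = here z≡x
∈-fromList⁻ (_ ∷ uxs) (there# z∈xs) = there (∈-fromList⁻ uxs z∈xs)

length-fromList : ∀ {xs : List ℕ} (uxs : Uniqueₗ xs) → Fresh.length (Fresh.fromList uxs) ≡ length xs
length-fromList []        = refl
length-fromList (_ ∷ uxs) = cong suc (length-fromList uxs)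

saturated : ∀ {xs ys : List ℕ} → Uniqueₗ xs → Uniqueₗ ys → (∀ {z} → z ∈ₗ xs → z ∈ₗ ys) →
            length ys ≤ length xs → ∀ {z} → z ∈ₗ ys → z ∈ₗ xs
saturated {xs} uxs uys xs⊆ys |ys|≤|xs| {z} z∈ys with z ∈? xs
... | yes z∈xs = z∈xs
... | no  z∉xs = contradiction (strict-injection id inclusion missing) (≤⇒≯ lengths)
  where
  inclusion : ∀ {u} → u ∈# Fresh.fromList uxs → u ∈# Fresh.fromList uys
  inclusion = ∈-fromList⁺ uys ∘ xs⊆ys ∘ ∈-fromList⁻ uxs
  missing : Σ ℕ λ u → u ∈# Fresh.fromList uys × ¬ u ∈# Fresh.fromList uxs
  missing = z , ∈-fromList⁺ uys z∈ys , z∉xs ∘ ∈-fromList⁻ uxs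
  lengths : Fresh.length (Fresh.fromList uys) ≤ Fresh.length (Fresh.fromList uxs)
  lengths = subst₂ _≤_ (sym (length-fromList uys)) (sym (length-fromList uxs)) |ys|≤|xs|

reflect-unique : ∀ T xs → Decreasing xs → Allₗ (_≤ T) xs → Uniqueₗ (map (T ∸_) xs)
reflect-unique T []       _            _            = []
reflect-unique T (x ∷ xs) (x>xs ∷ dxs) (x≤T ∷ xs≤T) =
  Allₚ.map⁺ (Allₗ.zipWith (λ (u<x , _) → <⇒≢ (∸-monoʳ-< u<x x≤T)) (x>xs , xs≤T))
  ∷ reflect-unique T xs dxs xs≤T

halves-agree : ∀ {x y P Q} → Q ≤ P → 2 * x ≡ (P ∸ Q) + 2 → 2 * y + Q ≡ P + 2 → x ≡ y
halves-agree {x} {y} {P} {Q} Q≤P 2x≡ 2y+Q≡ = *-cancelˡ-≡ x y 2 (+-cancelʳ-≡ Q _ _ (begin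
  2 * x + Q         ≡⟨ cong (_+ Q) 2x≡ ⟩
  (P ∸ Q) + 2 + Q   ≡⟨ +-assoc (P ∸ Q) 2 Q ⟩
  (P ∸ Q) + (2 + Q) ≡⟨ cong ((P ∸ Q) +_) (+-comm 2 Q) ⟩
  (P ∸ Q) + (Q + 2) ≡⟨ +-assoc (P ∸ Q) Q 2 ⟨
  (P ∸ Q) + Q + 2   ≡⟨ cong (_+ 2) (m∸n+n≡m Q≤P) ⟩
  P + 2             ≡⟨ 2y+Q≡ ⟨
  2 * y + Q         ∎))
  where open ≡-Reasoning

module ChainComplements {k} (α β : ℕ) (α+β≡k : α + β ≡ k)
                        (A : Vec ℕ k) (uA : Unique A) (0<A : Allₗ (0 <_) (toList A)) where

  enumeration : Σ (List ℕ) λ r → Decreasing r × r ↭ toList A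
  enumeration = decreasingEnumeration A uA

  r : List ℕ
  r = proj₁ enumeration

  r-decreasing : Decreasing r
  r-decreasing = proj₁ (proj₂ enumeration)

  r↭A : r ↭ toList A
  r↭A = proj₂ (proj₂ enumeration)

  r-positive : Allₗ (0 <_) r
  r-positive = All-resp-↭ (↭-sym r↭A) 0<A

  r-length : length r ≡ k
  r-length = trans (↭-length r↭A) (length-toList A)

  r⊆A : ∀ {z} → z ∈ₗ r → z ∈ A
  r⊆A = ∈-toList⁻ ∘ ∈-resp-↭ r↭A

  A⊆r : ∀ {z} → z ∈ A → z ∈ₗ r
  A⊆r = ∈-resp-↭ (↭-sym r↭A) ∘ ∈-toList⁺

  T : ℕ
  T = sum (toList A)

  chain-complement : ∀ {c} → c ∈ₗ chain β r → Σ ℕ λ s → s ∈ₗ Sigma α A × s + c ≡ T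
  chain-complement c∈ =
    let L , L⊑r , |L|≤β , sL≡c = chain⊆sublistSums β r c∈
        s , s∈Σ , s+sL≡T = complement∈Sigma α A uA (AllPairs-⊑ L⊑r (AllPairs.map >⇒≢ r-decreasing))
                             (r⊆A ∘ Any-resp-⊆ L⊑r) (≤-trans (+-monoʳ-≤ α |L|≤β) (≤-reflexive α+β≡k))
    in s , s∈Σ , trans (cong (s +_) (sym sL≡c)) s+sL≡T

  chain≤T : ∀ {c} → c ∈ₗ chain β r → c ≤ T
  chain≤T c∈ = let s , _ , s+c≡T = chain-complement c∈ in subst (_ ≤_) s+c≡T (m≤n+m _ s)

  complements : List ℕ
  complements = map (T ∸_) (chain β r)

  complements⊆Sigma : ∀ {z} → z ∈ₗ complements → z ∈ₗ Sigma α A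
  complements⊆Sigma z∈ with ∈-map⁻ (T ∸_) z∈
  ... | c , c∈ , refl = let s , s∈Σ , s+c≡T = chain-complement c∈
                        in subst (_∈ₗ Sigma α A) (trans (sym (m+n∸n≡m s c)) (cong (_∸ c) s+c≡T)) s∈Σ

  complements-unique : Uniqueₗ complements
  complements-unique = reflect-unique T (chain β r)
    (chain-decreasing β r r-decreasing r-positive) (Allₗ.tabulate chain≤T)

  card≡chain-length : 2 * cardSigma α A ≡ (k * (k + 1) ∸ α * (α + 1)) + 2 →
                      cardSigma α A ≡ length (chain β r)
  card≡chain-length hyp = halves-agree (*-mono-≤ α≤k (+-monoˡ-≤ 1 α≤k)) hyp
    (subst (λ n → 2 * length (chain β r) + α * (α + 1) ≡ n * (n + 1) + 2) r-length
      (chain-length β α r (trans (+-comm β α) (trans α+β≡k (sym r-length)))))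
    where
    α≤k : α ≤ k
    α≤k = subst (α ≤_) α+β≡k (m≤m+n α β)

  Sigma⊆complements : cardSigma α A ≡ length (chain β r) → ∀ {z} → z ∈ₗ Sigma α A → z ∈ₗ complements
  Sigma⊆complements |Σ|≡|chain| = saturated complements-unique (deduplicate-! _) complements⊆Sigma
    (≤-reflexive (trans |Σ|≡|chain| (sym (length-map (T ∸_) (chain β r)))))

  pairSum∈chain : cardSigma α A ≡ length (chain β r) → 2 ≤ β →
                  ∀ {p q} → p ∈ₗ r → q ∈ₗ r → p ≢ q → p + q ∈ₗ chain β r
  pairSum∈chain |Σ|≡|chain| 2≤β {p} {q} p∈r q∈r p≢q = subst (_∈ₗ chain β r) c≡p+q c∈chain
    where
    pair : Σ ℕ λ s → s ∈ₗ Sigma α A × s + (p + (q + 0)) ≡ T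
    pair = complement∈Sigma α A uA ((p≢q ∷ []) ∷ [] ∷ []) (Allₗ.lookup (r⊆A p∈r ∷ r⊆A q∈r ∷ []))
             (≤-trans (+-monoʳ-≤ α 2≤β) (≤-reflexive α+β≡k))
    s = proj₁ pair
    asComplement = ∈-map⁻ (T ∸_) (Sigma⊆complements |Σ|≡|chain| (proj₁ (proj₂ pair)))
    c = proj₁ asComplement
    c∈chain = proj₁ (proj₂ asComplement)
    c≡p+q : c ≡ p + q
    c≡p+q = +-cancelˡ-≡ s c (p + q) (begin
      s + c             ≡⟨ cong (_+ c) (proj₂ (proj₂ asComplement)) ⟩
      T ∸ c + c         ≡⟨ m∸n+n≡m (chain≤T c∈chain) ⟩
      T                 ≡⟨ proj₂ (proj₂ pair) ⟨
      s + (p + (q + 0)) ≡⟨ cong (λ q′ → s + (p + q′)) (+-identityʳ q) ⟩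
      s + (p + q)       ∎)
      where open ≡-Reasoning

multiples : ℕ → ℕ → List ℕ
multiples d zero    = []
multiples d (suc n) = suc n * d ∷ multiples d n

multiples-≤ : ∀ d n {u} → u ∈ₗ multiples d n → u ≤ n * d
multiples-≤ d (suc n) (here refl)  = ≤-refl
multiples-≤ d (suc n) (there u∈)   = ≤-trans (multiples-≤ d n u∈) (m≤n+m (n * d) d)

d∈multiples : ∀ d n → d ∈ₗ multiples d (suc n)
d∈multiples d zero    = here (sym (+-identityʳ d))
d∈multiples d (suc n) = there (d∈multiples d n)

∈-multiples⁻ : ∀ d n {u} → u ∈ₗ multiples d n → Σ ℕ λ i → (1 ≤ i × i ≤ n) × u ≡ d * i
∈-multiples⁻ d (suc n) (here refl) = suc n , (s≤s z≤n , ≤-refl) , *-comm (suc n) d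
∈-multiples⁻ d (suc n) (there u∈)  =
  let i , (1≤i , i≤n) , u≡di = ∈-multiples⁻ d n u∈ in i , (1≤i , m≤n⇒m≤1+n i≤n) , u≡di

∈-multiples⁺ : ∀ d n {u} → Σ ℕ (λ i → (1 ≤ i × i ≤ n) × u ≡ d * i) → u ∈ₗ multiples d n
∈-multiples⁺ d zero    (suc _ , (_ , ()) , _)
∈-multiples⁺ d (suc n) (i , (1≤i , i≤1+n) , u≡di) with m≤n⇒m<n∨m≡n i≤1+n
... | inj₁ (s≤s i≤n) = there (∈-multiples⁺ d n (i , (1≤i , i≤n) , u≡di))
... | inj₂ refl      = here (trans u≡di (*-comm d (suc n)))

DownClosed : ℕ → List ℕ → Set
DownClosed d w = ∀ {u} → u ∈ₗ w → u ≡ d ⊎ Σ ℕ λ u′ → u′ ∈ₗ w × u ≡ u′ + d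

nextMultiple : ∀ {d x} m → 0 < d → Allₗ (_< x) (multiples d m) →
               x ≡ d ⊎ (Σ ℕ λ u′ → u′ ∈ₗ x ∷ multiples d m × x ≡ u′ + d) → x ≡ suc m * d
nextMultiple {d} zero    _   _          (inj₁ x≡d) = trans x≡d (sym (+-identityʳ d))
nextMultiple (suc m)     _   (md<x ∷ _) (inj₁ refl) = contradiction (m≤m+n _ (m * _)) (<⇒≱ md<x)
nextMultiple {d} {x} m   0<d _          (inj₂ (.x , here refl , x≡x+d)) =
  contradiction (trans (+-identityʳ x) x≡x+d) (<⇒≢ (+-monoʳ-< x 0<d))
nextMultiple {d} (suc m) _   _          (inj₂ (u′ , there (here refl) , refl)) = +-comm (suc m * d) d
nextMultiple {d} (suc m) _   (md<x ∷ _) (inj₂ (u′ , there (there u′∈) , refl)) =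
  contradiction (+-monoˡ-≤ d (multiples-≤ d m u′∈)) (<⇒≱ (subst (_< u′ + d) (+-comm d (m * d)) md<x))

ladder : ∀ {d} → 0 < d → ∀ w → Decreasing w → DownClosed d w → w ≡ multiples d (length w)
ladder 0<d []       _            _      = refl
ladder {d} 0<d (x ∷ w) (x>w ∷ dw) closed = cong₂ _∷_ x≡top w≡multiples
  where
  -- The head x cannot be the u′ of a smaller entry u = u′ + d, so the tail stays down-closed.
  closed′ : DownClosed d w
  closed′ u∈ with closed (there u∈)
  ... | inj₁ u≡d                   = inj₁ u≡d
  ... | inj₂ (u′ , there u′∈ , u≡) = inj₂ (u′ , u′∈ , u≡)
  ... | inj₂ (_ , here refl , u≡x+d) =
        contradiction (subst (_ ≤_) (sym u≡x+d) (m≤m+n _ d)) (<⇒≱ (Allₗ.lookup x>w u∈))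
  w≡multiples : w ≡ multiples d (length w)
  w≡multiples = ladder 0<d w dw closed′
  x≡top : x ≡ suc (length w) * d
  x≡top = nextMultiple (length w) 0<d (subst (Allₗ (_< x)) w≡multiples x>w)
            (map₂ (λ (u′ , u′∈ , x≡) → u′ , subst (λ v → u′ ∈ₗ x ∷ v) w≡multiples u′∈ , x≡)
                  (closed (here refl)))

chain-between : ∀ {b y z w c} → Decreasing (y ∷ z ∷ w) → c ∈ₗ chain (suc (suc b)) (y ∷ z ∷ w) →
                z < c → c < y + z → c ≡ y ⊎ Σ ℕ λ u → u ∈ₗ w × c ≡ y + u
chain-between {b} {y} {z} {w} {c} (y>zw ∷ dzw) c∈ z<c c<y+z with y ≤? c
... | no y≰c with chain-below-head {suc b} c∈ (≰⇒> y≰c)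
...   | inj₁ c∈zw = contradiction (≤-head dzw c∈zw) (<⇒≱ z<c)
...   | inj₂ refl = contradiction z<c n≮0
chain-between {b} {y} {z} {w} {c} (y>zw ∷ dzw) c∈ z<c c<y+z
    | yes y≤c with chain-from-head {suc b} y>zw (≤-<-trans z≤n (Allₗ.lookup y>zw (here refl))) c∈ y≤c
...   | c′ , c′∈ , refl with chain-below-head {b} c′∈ (+-cancelˡ-< y c′ z c<y+z)
...     | inj₁ c′∈w = inj₂ (c′ , c′∈w , refl)
...     | inj₂ refl = inj₁ (+-identityʳ y)

-- Writing r = y ∷ z ∷ w and
-- d = y − z, the sums z + u (u ∈ w) make w down-closed, and the sum of the extreme entries
-- of w pins down z.
rigidity : ∀ β r → 2 ≤ β → 4 ≤ length r → Decreasing r → Allₗ (0 <_) r →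
           (∀ {p q} → p ∈ₗ r → q ∈ₗ r → p ≢ q → p + q ∈ₗ chain β r) →
           Σ ℕ λ d → 0 < d × r ≡ multiples d (length r)
rigidity (suc (suc b)) (y ∷ z ∷ w) (s≤s (s≤s z≤n)) (s≤s (s≤s 2≤|w|)) dr@(y>zw ∷ z>w ∷ dw) (_ ∷ _ ∷ 0<w) pairSums =
  d , 0<d , lastTwo (length w) 2≤|w| (ladder 0<d w dw closed)
  where
  z<y : z < y
  z<y = Allₗ.lookup y>zw (here refl)
  d : ℕ
  d = y ∸ z
  0<d : 0 < d
  0<d = m<n⇒0<n∸m z<y
  y≡z+d : y ≡ z + d
  y≡z+d = sym (m+[n∸m]≡n (<⇒≤ z<y))

  closed : DownClosed d w
  closed {u} u∈w with chain-between {b} dr (pairSums (there (here refl)) (there (there u∈w)) z≢u)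
                        (m<m+n z (Allₗ.lookup 0<w u∈w)) z+u<y+z
    where
    u<z = Allₗ.lookup z>w u∈w
    z≢u = <⇒≢ u<z ∘ sym
    z+u<y+z = subst (z + u <_) (+-comm z y) (+-monoʳ-< z (<-trans u<z z<y))
  ... | inj₁ z+u≡y = inj₁ (+-cancelˡ-≡ z u d (trans z+u≡y y≡z+d))
  ... | inj₂ (u′ , u′∈w , z+u≡y+u′) = inj₂ (u′ , u′∈w , +-cancelˡ-≡ z u (u′ + d) (begin
        z + u        ≡⟨ z+u≡y+u′ ⟩
        y + u′       ≡⟨ cong (_+ u′) y≡z+d ⟩
        z + d + u′   ≡⟨ +-assoc z d u′ ⟩
        z + (d + u′) ≡⟨ cong (z +_) (+-comm d u′) ⟩
        z + (u′ + d) ∎))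
    where open ≡-Reasoning

  -- With w = [m d, …, d] and m ≥ 2, the sum m d + d of two distinct entries lies below y,
  -- hence equals z.
  lastTwo : ∀ m → 2 ≤ m → w ≡ multiples d m → y ∷ z ∷ w ≡ multiples d (suc (suc m))
  lastTwo (suc zero) (s≤s ()) _
  lastTwo (suc (suc m)) _ w≡ = cong₂ _∷_ y≡ (cong₂ _∷_ z≡ w≡)
    where
    top = suc (suc m) * d
    top∈w : top ∈ₗ w
    top∈w = subst (top ∈ₗ_) (sym w≡) (here refl)
    top≢d : top ≢ d
    top≢d = <⇒≢ (m<m+n d (<-≤-trans 0<d (m≤m+n d (m * d)))) ∘ sym
    below : top + d < y
    below = subst (top + d <_) (sym y≡z+d) (+-monoˡ-< d (Allₗ.lookup z>w top∈w))
    z≡ : z ≡ suc (suc (suc m)) * d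
    z≡ with chain-below-head {suc b} {y} {z ∷ w} (pairSums (there (there top∈w))
                                      (there (there (subst (d ∈ₗ_) (sym w≡) (d∈multiples d (suc m)))))
                                      top≢d) below
    ... | inj₁ (here top+d≡z) = trans (sym top+d≡z) (+-comm top d)
    ... | inj₁ (there top+d∈w) =
          contradiction (multiples-≤ d _ (subst (top + d ∈ₗ_) w≡ top+d∈w)) (<⇒≱ (m<m+n top 0<d))
    ... | inj₂ top+d≡0 = contradiction top+d≡0 (<⇒≢ (<-≤-trans 0<d (m≤n+m d top)) ∘ sym)
    y≡ : y ≡ suc (suc (suc (suc m))) * d
    y≡ = trans y≡z+d (trans (cong (_+ d) z≡) (+-comm _ d))

2≤k∸α : ∀ {k α} → 2 ≤ k → α ≤ k ∸ 2 → 2 ≤ k ∸ α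
2≤k∸α {k} {α} 2≤k α≤k∸2 = subst (_≤ k ∸ α) (m∸[m∸n]≡n 2≤k) (∸-monoʳ-≤ k α≤k∸2)

theorem2p2 : (k α : ℕ) → 4 ≤ k → α ≤ k ∸ 2 →
    (A : Vec ℕ k) → Unique A → All (0 <_) A →
    2 * cardSigma α A ≡ (k * (k + 1) ∸ α * (α + 1)) + 2 →
    Σ ℕ (λ d → 0 < d × ((x : ℕ) → x ∈ A ⇔ Σ ℕ (λ i → (1 ≤ i × i ≤ k) × x ≡ d * i)))
theorem2p2 k α 4≤k α≤k∸2 A uA 0<A hyp =
  d , 0<d , λ x → mk⇔ (∈-multiples⁻ d k ∘ subst (x ∈ₗ_) r≡multiples ∘ A⊆r)
                      (r⊆A ∘ subst (x ∈ₗ_) (sym r≡multiples) ∘ ∈-multiples⁺ d k)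
  where
  β : ℕ
  β = k ∸ α
  2≤β : 2 ≤ β
  2≤β = 2≤k∸α (≤-trans (s≤s (s≤s z≤n)) 4≤k) α≤k∸2
  open ChainComplements α β (m+[n∸m]≡n (≤-trans α≤k∸2 (m∸n≤m k 2))) A uA (VecAll.toList⁺ 0<A)
  progression : Σ ℕ λ d → 0 < d × r ≡ multiples d (length r)
  progression = rigidity β r 2≤β (subst (4 ≤_) (sym r-length) 4≤k) r-decreasing r-positive
                  (pairSum∈chain (card≡chain-length hyp) 2≤β)
  d : ℕ
  d = proj₁ progression
  0<d : 0 < d
  0<d = proj₁ (proj₂ progression)
  r≡multiples : r ≡ multiples d k
  r≡multiples = trans (proj₂ (proj₂ progression)) (cong (multiples d) r-length)
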